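{- If $n\ge 5$ is an odd integer, then $\chi(Q_{n}^{[\natural n-3]})\le 15$.
   Context: $Q_n^{[\natural p]}$ is the graph on $\{0,1\}^n$ in which two vertices are adjacent iff they differ in exactly $p$ coordinates. $\chi$ denotes the chromatic number. -}

module Defs where

open import Data.Nat using (ℕ; zero; suc; _+_; _∸_)
open import Data.Bool using (Bool; true; false)
open import Data.Vec using (Vec; []; _∷_)
open import Data.Fin using (Fin)
open import Data.Product using (Σ)
open import Relation.Binary.PropositionalEquality using (_≡_; _≢_)

hamming : ∀ {n} → Vec Bool n → Vec Bool n → ℕ
hamming [] [] = 0
hamming (true  ∷ xs) (true  ∷ ys) = hamming xs ys
hamming (false ∷ xs) (false ∷ ys) = hamming xs ys
hamming (true  ∷ xs) (false ∷ ys) = suc (hamming xs ys)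
hamming (false ∷ xs) (true  ∷ ys) = suc (hamming xs ys)

-- Adjacency in Q_n^{[♮p]}: vertices {0,1}^n, adjacent iff they differ in exactly p coordinates.
Adj : (n p : ℕ) → Vec Bool n → Vec Bool n → Set
Adj n p x y = hamming x y ≡ p

ProperColouring : (n p k : ℕ) → (Vec Bool n → Fin k) → Set
ProperColouring n p k c = ∀ x y → Adj n p x y → c x ≢ c y

χ≤ : (n p k : ℕ) → Set
χ≤ n p k = Σ (Vec Bool n → Fin k) (ProperColouring n p k)

-- For n ≥ 6 a word is coloured by its first six coordinates, using a partition
-- of Q₆ into 15 classes of diameter at most 2: two words of the same colour then
-- differ in at most 2 + (n − 6) = n − 4 < n − 3 coordinates. For n = 5 the graph
-- Q₅^{[♮2]} is coloured directly with 8 colours.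
module Submission where

open import Defs
open import Data.Nat using (ℕ; zero; suc; _+_; _∸_; _*_; _≤_; _<_; z≤n; s≤s; _≟_; _≤?_)
open import Data.Nat.Properties using (≤-refl; ≤-trans; n≤1+n; +-mono-≤; ≤⇒≯)
open import Data.Bool using (Bool; true; false)
open import Data.Vec using (Vec; []; _∷_; _++_; take; drop)
open import Data.Vec.Properties using (take++drop≡id)
open import Data.Fin using (Fin; #_)
import Data.Fin as Fin
open import Data.Product using (_,_)
open import Function using (_∘_)
open import Relation.Nullary using (Dec)
open import Relation.Nullary.Decidable using (map′; _×-dec_; _→-dec_; ¬?; toWitness)
open import Relation.Unary using (Pred; Decidable)
open import Relation.Binary.PropositionalEquality
  using (_≡_; refl; sym; cong; cong₂; subst; module ≡-Reasoning)

hamming-++ : ∀ {k l} (x y : Vec Bool k) (u v : Vec Bool l) →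
             hamming (x ++ u) (y ++ v) ≡ hamming x y + hamming u v
hamming-++ []          []          u v = refl
hamming-++ (true  ∷ x) (true  ∷ y) u v = hamming-++ x y u v
hamming-++ (false ∷ x) (false ∷ y) u v = hamming-++ x y u v
hamming-++ (true  ∷ x) (false ∷ y) u v = cong suc (hamming-++ x y u v)
hamming-++ (false ∷ x) (true  ∷ y) u v = cong suc (hamming-++ x y u v)

hamming≤length : ∀ {n} (x y : Vec Bool n) → hamming x y ≤ n
hamming≤length []          []          = z≤n
hamming≤length (true  ∷ x) (true  ∷ y) = ≤-trans (hamming≤length x y) (n≤1+n _)
hamming≤length (false ∷ x) (false ∷ y) = ≤-trans (hamming≤length x y) (n≤1+n _)
hamming≤length (true  ∷ x) (false ∷ y) = s≤s (hamming≤length x y)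
hamming≤length (false ∷ x) (true  ∷ y) = s≤s (hamming≤length x y)

hamming-take-drop : ∀ k {l} (x y : Vec Bool (k + l)) →
  hamming x y ≡ hamming (take k x) (take k y) + hamming (drop k x) (drop k y)
hamming-take-drop k x y = begin
  hamming x y
    ≡⟨ cong₂ hamming (sym (take++drop≡id k x)) (sym (take++drop≡id k y)) ⟩
  hamming (take k x ++ drop k x) (take k y ++ drop k y)
    ≡⟨ hamming-++ (take k x) (take k y) (drop k x) (drop k y) ⟩
  hamming (take k x) (take k y) + hamming (drop k x) (drop k y) ∎
  where open ≡-Reasoning

ClassDiameter≤ : (k d m : ℕ) → (Vec Bool k → Fin m) → Set
ClassDiameter≤ k d m c = ∀ x y → c x ≡ c y → hamming x y ≤ d

χ≤-by-prefix : ∀ {k l d m} p (c : Vec Bool k → Fin m) →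
               ClassDiameter≤ k d m c → d + l < p → χ≤ (k + l) p m
χ≤-by-prefix {k} {l} {d} {m} p c diam d+l<p = c ∘ take k , proper
  where
  proper : ProperColouring (k + l) p m (c ∘ take k)
  proper x y x~y cx≡cy = ≤⇒≯ (subst (_≤ d + l) x~y close) d+l<p
    where
    close : hamming x y ≤ d + l
    close = subst (_≤ d + l) (sym (hamming-take-drop k x y))
              (+-mono-≤ (diam (take k x) (take k y) cx≡cy)
                        (hamming≤length (drop k x) (drop k y)))

∀-word? : ∀ {ℓ} n {P : Pred (Vec Bool n) ℓ} → Decidable P → Dec (∀ x → P x)
∀-word? zero    P? = map′ (λ { P[] [] → P[] }) (λ f → f []) (P? [])
∀-word? (suc n) P? =
  map′ (λ { (t , f) (true ∷ x) → t x ; (t , f) (false ∷ x) → f x })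
       (λ g → g ∘ (true ∷_) , g ∘ (false ∷_))
       (∀-word? n (P? ∘ (true ∷_)) ×-dec ∀-word? n (P? ∘ (false ∷_)))

colour6 : Vec Bool 6 → Fin 15
colour6 (false ∷ false ∷ false ∷ false ∷ false ∷ false ∷ []) = # 0
colour6 (false ∷ false ∷ false ∷ false ∷ false ∷ true  ∷ []) = # 1
colour6 (false ∷ false ∷ false ∷ false ∷ true  ∷ false ∷ []) = # 0
colour6 (false ∷ false ∷ false ∷ false ∷ true  ∷ true  ∷ []) = # 1
colour6 (false ∷ false ∷ false ∷ true  ∷ false ∷ false ∷ []) = # 0
colour6 (false ∷ false ∷ false ∷ true  ∷ false ∷ true  ∷ []) = # 1
colour6 (false ∷ false ∷ false ∷ true  ∷ true  ∷ false ∷ []) = # 2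
colour6 (false ∷ false ∷ false ∷ true  ∷ true  ∷ true  ∷ []) = # 3
colour6 (false ∷ false ∷ true  ∷ false ∷ false ∷ false ∷ []) = # 0
colour6 (false ∷ false ∷ true  ∷ false ∷ false ∷ true  ∷ []) = # 1
colour6 (false ∷ false ∷ true  ∷ false ∷ true  ∷ false ∷ []) = # 2
colour6 (false ∷ false ∷ true  ∷ false ∷ true  ∷ true  ∷ []) = # 3
colour6 (false ∷ false ∷ true  ∷ true  ∷ false ∷ false ∷ []) = # 4
colour6 (false ∷ false ∷ true  ∷ true  ∷ false ∷ true  ∷ []) = # 5
colour6 (false ∷ false ∷ true  ∷ true  ∷ true  ∷ false ∷ []) = # 6
colour6 (false ∷ false ∷ true  ∷ true  ∷ true  ∷ true  ∷ []) = # 7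
colour6 (false ∷ true  ∷ false ∷ false ∷ false ∷ false ∷ []) = # 0
colour6 (false ∷ true  ∷ false ∷ false ∷ false ∷ true  ∷ []) = # 1
colour6 (false ∷ true  ∷ false ∷ false ∷ true  ∷ false ∷ []) = # 2
colour6 (false ∷ true  ∷ false ∷ false ∷ true  ∷ true  ∷ []) = # 3
colour6 (false ∷ true  ∷ false ∷ true  ∷ false ∷ false ∷ []) = # 4
colour6 (false ∷ true  ∷ false ∷ true  ∷ false ∷ true  ∷ []) = # 5
colour6 (false ∷ true  ∷ false ∷ true  ∷ true  ∷ false ∷ []) = # 6
colour6 (false ∷ true  ∷ false ∷ true  ∷ true  ∷ true  ∷ []) = # 7
colour6 (false ∷ true  ∷ true  ∷ false ∷ false ∷ false ∷ []) = # 12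
colour6 (false ∷ true  ∷ true  ∷ false ∷ false ∷ true  ∷ []) = # 13
colour6 (false ∷ true  ∷ true  ∷ false ∷ true  ∷ false ∷ []) = # 6
colour6 (false ∷ true  ∷ true  ∷ false ∷ true  ∷ true  ∷ []) = # 7
colour6 (false ∷ true  ∷ true  ∷ true  ∷ false ∷ false ∷ []) = # 6
colour6 (false ∷ true  ∷ true  ∷ true  ∷ false ∷ true  ∷ []) = # 7
colour6 (false ∷ true  ∷ true  ∷ true  ∷ true  ∷ false ∷ []) = # 6
colour6 (false ∷ true  ∷ true  ∷ true  ∷ true  ∷ true  ∷ []) = # 7
colour6 (true  ∷ false ∷ false ∷ false ∷ false ∷ false ∷ []) = # 0
colour6 (true  ∷ false ∷ false ∷ false ∷ false ∷ true  ∷ []) = # 1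
colour6 (true  ∷ false ∷ false ∷ false ∷ true  ∷ false ∷ []) = # 2
colour6 (true  ∷ false ∷ false ∷ false ∷ true  ∷ true  ∷ []) = # 3
colour6 (true  ∷ false ∷ false ∷ true  ∷ false ∷ false ∷ []) = # 4
colour6 (true  ∷ false ∷ false ∷ true  ∷ false ∷ true  ∷ []) = # 5
colour6 (true  ∷ false ∷ false ∷ true  ∷ true  ∷ false ∷ []) = # 8
colour6 (true  ∷ false ∷ false ∷ true  ∷ true  ∷ true  ∷ []) = # 9
colour6 (true  ∷ false ∷ true  ∷ false ∷ false ∷ false ∷ []) = # 12
colour6 (true  ∷ false ∷ true  ∷ false ∷ false ∷ true  ∷ []) = # 13
colour6 (true  ∷ false ∷ true  ∷ false ∷ true  ∷ false ∷ []) = # 8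
colour6 (true  ∷ false ∷ true  ∷ false ∷ true  ∷ true  ∷ []) = # 9
colour6 (true  ∷ false ∷ true  ∷ true  ∷ false ∷ false ∷ []) = # 8
colour6 (true  ∷ false ∷ true  ∷ true  ∷ false ∷ true  ∷ []) = # 9
colour6 (true  ∷ false ∷ true  ∷ true  ∷ true  ∷ false ∷ []) = # 8
colour6 (true  ∷ false ∷ true  ∷ true  ∷ true  ∷ true  ∷ []) = # 9
colour6 (true  ∷ true  ∷ false ∷ false ∷ false ∷ false ∷ []) = # 12
colour6 (true  ∷ true  ∷ false ∷ false ∷ false ∷ true  ∷ []) = # 13
colour6 (true  ∷ true  ∷ false ∷ false ∷ true  ∷ false ∷ []) = # 10
colour6 (true  ∷ true  ∷ false ∷ false ∷ true  ∷ true  ∷ []) = # 11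
colour6 (true  ∷ true  ∷ false ∷ true  ∷ false ∷ false ∷ []) = # 10
colour6 (true  ∷ true  ∷ false ∷ true  ∷ false ∷ true  ∷ []) = # 11
colour6 (true  ∷ true  ∷ false ∷ true  ∷ true  ∷ false ∷ []) = # 10
colour6 (true  ∷ true  ∷ false ∷ true  ∷ true  ∷ true  ∷ []) = # 11
colour6 (true  ∷ true  ∷ true  ∷ false ∷ false ∷ false ∷ []) = # 12
colour6 (true  ∷ true  ∷ true  ∷ false ∷ false ∷ true  ∷ []) = # 13
colour6 (true  ∷ true  ∷ true  ∷ false ∷ true  ∷ false ∷ []) = # 12
colour6 (true  ∷ true  ∷ true  ∷ false ∷ true  ∷ true  ∷ []) = # 13
colour6 (true  ∷ true  ∷ true  ∷ true  ∷ false ∷ false ∷ []) = # 12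
colour6 (true  ∷ true  ∷ true  ∷ true  ∷ false ∷ true  ∷ []) = # 13
colour6 (true  ∷ true  ∷ true  ∷ true  ∷ true  ∷ false ∷ []) = # 6
colour6 (true  ∷ true  ∷ true  ∷ true  ∷ true  ∷ true  ∷ []) = # 7

colour6-diameter≤2 : ClassDiameter≤ 6 2 15 colour6
colour6-diameter≤2 = toWitness {a? = ∀-word? 6 λ x → ∀-word? 6 λ y →
                                      (colour6 x Fin.≟ colour6 y) →-dec (hamming x y ≤? 2)} _

-- The classes are the cosets of the code {0000, 1101}, of minimum distance 3;
-- it separates the tails of two words at distance 2, which are at distance 1 or 2.
colour5 : Vec Bool 5 → Fin 15
colour5 (_ ∷ false ∷ false ∷ false ∷ false ∷ []) = # 0
colour5 (_ ∷ false ∷ false ∷ false ∷ true  ∷ []) = # 3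
colour5 (_ ∷ false ∷ false ∷ true  ∷ false ∷ []) = # 4
colour5 (_ ∷ false ∷ false ∷ true  ∷ true  ∷ []) = # 7
colour5 (_ ∷ false ∷ true  ∷ false ∷ false ∷ []) = # 2
colour5 (_ ∷ false ∷ true  ∷ false ∷ true  ∷ []) = # 1
colour5 (_ ∷ false ∷ true  ∷ true  ∷ false ∷ []) = # 6
colour5 (_ ∷ false ∷ true  ∷ true  ∷ true  ∷ []) = # 5
colour5 (_ ∷ true  ∷ false ∷ false ∷ false ∷ []) = # 1
colour5 (_ ∷ true  ∷ false ∷ false ∷ true  ∷ []) = # 2
colour5 (_ ∷ true  ∷ false ∷ true  ∷ false ∷ []) = # 5
colour5 (_ ∷ true  ∷ false ∷ true  ∷ true  ∷ []) = # 6
colour5 (_ ∷ true  ∷ true  ∷ false ∷ false ∷ []) = # 3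
colour5 (_ ∷ true  ∷ true  ∷ false ∷ true  ∷ []) = # 0
colour5 (_ ∷ true  ∷ true  ∷ true  ∷ false ∷ []) = # 7
colour5 (_ ∷ true  ∷ true  ∷ true  ∷ true  ∷ []) = # 4

colour5-proper : ProperColouring 5 2 15 colour5
colour5-proper = toWitness {a? = ∀-word? 5 λ x → ∀-word? 5 λ y →
                                  (hamming x y ≟ 2) →-dec ¬? (colour5 x Fin.≟ colour5 y)} _

χ≤-n∸3 : ∀ {n} → 5 ≤ n → χ≤ n (n ∸ 3) 15
χ≤-n∸3 (s≤s (s≤s (s≤s (s≤s (s≤s (z≤n {zero})))))) = colour5 , colour5-proper
χ≤-n∸3 (s≤s (s≤s (s≤s (s≤s (s≤s (z≤n {suc l})))))) =
  χ≤-by-prefix (3 + l) colour6 colour6-diameter≤2 ≤-refl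

corollary4p18 : (m : ℕ) → 5 ≤ 2 * m + 1 → χ≤ (2 * m + 1) ((2 * m + 1) ∸ 3) 15
corollary4p18 m 5≤n = χ≤-n∸3 5≤n
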